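{- Let $\sigma,\pi$ be permutations, $\Sigma=(S_1,\dots,S_t)$ a $t$-monotone partition of $\sigma$ and $\Pi=(S'_1,\dots,S'_t)$ a $t$-monotone partition of $\pi$. For $x,y\in S(\sigma)$ and $\alpha\in\{1,2\}$ with $x<^\sigma_\alpha y$, $x\in S_i$, $y\in S_j$, let $R_{x,y,\alpha}=\{(x',y'):x'\in S'_i,\ y'\in S'_j,\ x'<^\pi_\alpha y'\}$. Then both $\mathrm{mid}_1$ and $\mathrm{mid}_2$ are polymorphisms of every relation $R_{x,y,\alpha}$.
   Context: A permutation is a pair $\pi=(S,P)$, $S$ a finite set of positive integers, $P:S\to\mathbb{N}^2$ injective with $P(S)$ in general position; $\pi|S'=(S',P|_{S'})$. For $\alpha\in\{1,2\}$, $p<^{\pi}_{\alpha}p'$ means the $\alpha$-th coordinate of $P(p)$ is smaller than that of $P(p')$, and $\le^\pi_\alpha$ is the corresponding non-strict order. $\pi$ is increasing (resp. decreasing) if for all $p,p'$, $p<^\pi_1p'$ iff $p<^\pi_2p'$ (resp. iff $p'<^\pi_2p$); monotone if either. A $t$-monotone partition of $\pi$ is a partition $(S_1,\dots,S_t)$ of $S(\pi)$ with each $\pi|S_i$ monotone. For $x'_1,x'_2,x'_3\in S(\pi)$, $\mathrm{mid}_\alpha(x'_1,x'_2,x'_3)$ is the median of the three elements with respect to $\le^\pi_\alpha$. A ternary function $f:D^3\to D$ is a polymorphism of a binary relation $R\subseteq D^2$ if for all $(a_1,b_1),(a_2,b_2),(a_3,b_3)\in R$, $(f(a_1,a_2,a_3),f(b_1,b_2,b_3))\in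 R$; here $D=S(\pi)$. -}

module Defs where

open import Data.Nat using (ℕ; _<_; _≤ᵇ_)
open import Data.Bool using (if_then_else_)
open import Data.Fin using (Fin)
open import Data.Product using (_×_; proj₁; proj₂)
open import Data.Sum using (_⊎_)
open import Data.List using (List)
open import Data.List.Membership.Propositional using (_∈_)
open import Data.List.Relation.Unary.All using (All)
open import Data.List.Relation.Unary.Unique.Propositional using (Unique)
open import Relation.Binary.PropositionalEquality using (_≡_; _≢_)
open import Function.Bundles using (_⇔_)

data Axis : Set where
  ax1 ax2 : Axis

coord : Axis → ℕ × ℕ → ℕ
coord ax1 = proj₁
coord ax2 = proj₂

-- A permutation π = (S, P): S a finite set of positive integers (a
-- duplicate-free list), P : S → ℕ² injective with P(S) in general position
-- (no two points share a coordinate; this implies injectivity).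
-- P is given as a total function ℕ → ℕ²; only its values on S matter.
record Permutation : Set where
  field
    S       : List ℕ
    S-uniq  : Unique S
    S-pos   : All (λ n → 0 < n) S
    P       : ℕ → ℕ × ℕ
    general : ∀ {p q} → p ∈ S → q ∈ S → p ≢ q →
              (coord ax1 (P p) ≢ coord ax1 (P q)) × (coord ax2 (P p) ≢ coord ax2 (P q))
open Permutation public

_⊢_<[_]_ : Permutation → ℕ → Axis → ℕ → Set
π ⊢ p <[ α ] q = coord α (P π p) < coord α (P π q)

Increasing : (π : Permutation) → (ℕ → Set) → Set
Increasing π U = ∀ p q → U p → U q → ((π ⊢ p <[ ax1 ] q) ⇔ (π ⊢ p <[ ax2 ] q))

Decreasing : (π : Permutation) → (ℕ → Set) → Set
Decreasing π U = ∀ p q → U p → U q → ((π ⊢ p <[ ax1 ] q) ⇔ (π ⊢ q <[ ax2 ] p))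

Monotone : (π : Permutation) → (ℕ → Set) → Set
Monotone π U = Increasing π U ⊎ Decreasing π U

-- A t-monotone partition (S_1,…,S_t) of π, given by the index map
-- p ↦ i with p ∈ S_i (parts indexed by Fin t); S_i = {p ∈ S(π) | part p ≡ i}.
record MonotonePartition (π : Permutation) (t : ℕ) : Set where
  field
    part     : ℕ → Fin t
    monotone : ∀ (i : Fin t) → Monotone π (λ p → (p ∈ S π) × (part p ≡ i))
open MonotonePartition public

median : (ℕ → ℕ) → ℕ → ℕ → ℕ → ℕ
median k a b c =
  if k a ≤ᵇ k b
  then (if k b ≤ᵇ k c then b else (if k a ≤ᵇ k c then c else a))
  else (if k a ≤ᵇ k c then a else (if k b ≤ᵇ k c then c else b))

mid : Axis → Permutation → ℕ → ℕ → ℕ → ℕ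
mid α π = median (λ p → coord α (P π p))

-- f is a polymorphism of the binary relation R ⊆ D² (R is given as a
-- predicate; the relations below are contained in S(π)²).
IsPolymorphism : (ℕ → ℕ → ℕ → ℕ) → (ℕ → ℕ → Set) → Set
IsPolymorphism f R = ∀ a₁ b₁ a₂ b₂ a₃ b₃ → R a₁ b₁ → R a₂ b₂ → R a₃ b₃ →
                     R (f a₁ a₂ a₃) (f b₁ b₂ b₃)

Rel : (σ π : Permutation) {t : ℕ} → MonotonePartition σ t → MonotonePartition π t →
      ℕ → ℕ → Axis → ℕ → ℕ → Set
Rel σ π Σ' Π x y α x' y' =
  (x' ∈ S π) × (part Π x' ≡ part Σ' x) ×
  (y' ∈ S π) × (part Π y' ≡ part Σ' y) ×
  (π ⊢ x' <[ α ] y')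

-- Inside a monotone block, the orders ≤₁ and ≤₂ agree or are opposite, so the
-- median for ≤_β of three points of one block is also a median for ≤_α. If
-- x′ᵢ <_α y′ᵢ for i = 1,2,3, then at least two x′ᵢ lie α-above mid(x′) and at
-- least two y′ᵢ lie α-below mid(y′); some index is in both majorities, giving
-- mid(x′) ≤_α x′ₖ <_α y′ₖ ≤_α mid(y′). The median of points of a block stays
-- in that block, so the median pair is again in R_{x,y,α}.
module Submission where

open import Defs
open import Data.Nat using (ℕ; _≤_; _<_; _≤ᵇ_; _≟_)
open import Data.Nat.Properties using (≤-refl; <-≤-trans; ≤-<-trans; <⇒≤; ≰⇒≥; ≤∧≢⇒<; ≤ᵇ-reflects-≤)
open import Data.Bool using (true; false)
open import Data.Product using (_×_; _,_; proj₁; proj₂)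
open import Data.Sum using (_⊎_; inj₁; inj₂)
open import Data.Fin using (Fin)
open import Data.List.Membership.Propositional using (_∈_)
open import Relation.Binary.PropositionalEquality using (_≡_; _≢_; refl)
open import Relation.Nullary using (yes; no)
open import Relation.Nullary.Reflects using (ofʸ; ofⁿ)
open import Function using (id)
open import Function.Bundles using (Equivalence)

Majority : Set → Set → Set → Set
Majority A B C = (A × B) ⊎ (A × C) ⊎ (B × C)

module _ {A B C A′ B′ C′ : Set} where

  Majority-map : (A → A′) → (B → B′) → (C → C′) → Majority A B C → Majority A′ B′ C′
  Majority-map f g h (inj₁ (a , b))         = inj₁ (f a , g b)
  Majority-map f g h (inj₂ (inj₁ (a , c)))  = inj₂ (inj₁ (f a , h c))
  Majority-map f g h (inj₂ (inj₂ (b , c)))  = inj₂ (inj₂ (g b , h c))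

  Majority-overlap : Majority A B C → Majority A′ B′ C′ → (A × A′) ⊎ (B × B′) ⊎ (C × C′)
  Majority-overlap (inj₁ (a , _))        (inj₁ (a′ , _))        = inj₁ (a , a′)
  Majority-overlap (inj₁ (a , _))        (inj₂ (inj₁ (a′ , _))) = inj₁ (a , a′)
  Majority-overlap (inj₁ (_ , b))        (inj₂ (inj₂ (b′ , _))) = inj₂ (inj₁ (b , b′))
  Majority-overlap (inj₂ (inj₁ (a , _))) (inj₁ (a′ , _))        = inj₁ (a , a′)
  Majority-overlap (inj₂ (inj₁ (a , _))) (inj₂ (inj₁ (a′ , _))) = inj₁ (a , a′)
  Majority-overlap (inj₂ (inj₁ (_ , c))) (inj₂ (inj₂ (_ , c′))) = inj₂ (inj₂ (c , c′))
  Majority-overlap (inj₂ (inj₂ (b , _))) (inj₁ (_ , b′))        = inj₂ (inj₁ (b , b′))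
  Majority-overlap (inj₂ (inj₂ (_ , c))) (inj₂ (inj₁ (_ , c′))) = inj₂ (inj₂ (c , c′))
  Majority-overlap (inj₂ (inj₂ (b , _))) (inj₂ (inj₂ (b′ , _))) = inj₂ (inj₁ (b , b′))

OneOf : ℕ → ℕ → ℕ → ℕ → Set
OneOf r a b c = r ≡ a ⊎ r ≡ b ⊎ r ≡ c

OneOf-preserves : ∀ {U : ℕ → Set} {r a b c} → OneOf r a b c → U a → U b → U c → U r
OneOf-preserves (inj₁ refl)        ua ub uc = ua
OneOf-preserves (inj₂ (inj₁ refl)) ua ub uc = ub
OneOf-preserves (inj₂ (inj₂ refl)) ua ub uc = uc

IsMedianBy : (ℕ → ℕ) → ℕ → ℕ → ℕ → ℕ → Set
IsMedianBy h r a b c = Majority (h a ≤ h r) (h b ≤ h r) (h c ≤ h r)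
                     × Majority (h r ≤ h a) (h r ≤ h b) (h r ≤ h c)

median-spec : ∀ (k : ℕ → ℕ) a b c →
              OneOf (median k a b c) a b c × IsMedianBy k (median k a b c) a b c
median-spec k a b c with k a ≤ᵇ k b | ≤ᵇ-reflects-≤ (k a) (k b)
median-spec k a b c | true | ofʸ ab with k b ≤ᵇ k c | ≤ᵇ-reflects-≤ (k b) (k c)
... | true  | ofʸ bc = inj₂ (inj₁ refl) , inj₁ (ab , ≤-refl) , inj₂ (inj₂ (≤-refl , bc))
... | false | ofⁿ b≰c with k a ≤ᵇ k c | ≤ᵇ-reflects-≤ (k a) (k c)
...   | true  | ofʸ ac  = inj₂ (inj₂ refl) , inj₂ (inj₁ (ac , ≤-refl)) , inj₂ (inj₂ (≰⇒≥ b≰c , ≤-refl))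
...   | false | ofⁿ a≰c = inj₁ refl , inj₂ (inj₁ (≤-refl , ≰⇒≥ a≰c)) , inj₁ (≤-refl , ab)
median-spec k a b c | false | ofⁿ a≰b with k a ≤ᵇ k c | ≤ᵇ-reflects-≤ (k a) (k c)
... | true  | ofʸ ac = inj₁ refl , inj₁ (≤-refl , ≰⇒≥ a≰b) , inj₂ (inj₁ (≤-refl , ac))
... | false | ofⁿ a≰c with k b ≤ᵇ k c | ≤ᵇ-reflects-≤ (k b) (k c)
...   | true  | ofʸ bc  = inj₂ (inj₂ refl) , inj₂ (inj₂ (bc , ≤-refl)) , inj₂ (inj₁ (≰⇒≥ a≰c , ≤-refl))
...   | false | ofⁿ b≰c = inj₂ (inj₁ refl) , inj₂ (inj₂ (≤-refl , ≰⇒≥ b≰c)) , inj₁ (≰⇒≥ a≰b , ≤-refl)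

IsMedianBy-mono : ∀ (h : ℕ → ℕ) {r s a₁ a₂ a₃ b₁ b₂ b₃} →
                  IsMedianBy h r a₁ a₂ a₃ → IsMedianBy h s b₁ b₂ b₃ →
                  h a₁ < h b₁ → h a₂ < h b₂ → h a₃ < h b₃ → h r < h s
IsMedianBy-mono h (_ , r≤a) (b≤s , _) a₁<b₁ a₂<b₂ a₃<b₃ with Majority-overlap r≤a b≤s
... | inj₁ (r≤a₁ , b₁≤s)        = ≤-<-trans r≤a₁ (<-≤-trans a₁<b₁ b₁≤s)
... | inj₂ (inj₁ (r≤a₂ , b₂≤s)) = ≤-<-trans r≤a₂ (<-≤-trans a₂<b₂ b₂≤s)
... | inj₂ (inj₂ (r≤a₃ , b₃≤s)) = ≤-<-trans r≤a₃ (<-≤-trans a₃<b₃ b₃≤s)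

module _ (U : ℕ → Set) (k h : ℕ → ℕ) where

  Monotoneᵘ Antitoneᵘ : Set
  Monotoneᵘ = ∀ {p q} → U p → U q → k p ≤ k q → h p ≤ h q
  Antitoneᵘ = ∀ {p q} → U p → U q → k p ≤ k q → h q ≤ h p

  IsMedianBy-transfer : Monotoneᵘ ⊎ Antitoneᵘ → ∀ {r a b c} → U r → U a → U b → U c →
                        IsMedianBy k r a b c → IsMedianBy h r a b c
  IsMedianBy-transfer (inj₁ mono) ur ua ub uc (below , above) =
    Majority-map (mono ua ur) (mono ub ur) (mono uc ur) below ,
    Majority-map (mono ur ua) (mono ur ub) (mono ur uc) above
  IsMedianBy-transfer (inj₂ anti) ur ua ub uc (below , above) =
    Majority-map (anti ur ua) (anti ur ub) (anti ur uc) above ,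
    Majority-map (anti ua ur) (anti ub ur) (anti uc ur) below

  module _ (k-injective : ∀ {p q} → U p → U q → p ≢ q → k p ≢ k q) where

    <-preserving⇒Monotoneᵘ : (∀ {p q} → U p → U q → k p < k q → h p < h q) → Monotoneᵘ
    <-preserving⇒Monotoneᵘ pres {p} {q} up uq kp≤kq with p ≟ q
    ... | yes refl = ≤-refl
    ... | no p≢q   = <⇒≤ (pres up uq (≤∧≢⇒< kp≤kq (k-injective up uq p≢q)))

    <-reversing⇒Antitoneᵘ : (∀ {p q} → U p → U q → k p < k q → h q < h p) → Antitoneᵘ
    <-reversing⇒Antitoneᵘ rev {p} {q} up uq kp≤kq with p ≟ q
    ... | yes refl = ≤-refl
    ... | no p≢q   = <⇒≤ (rev up uq (≤∧≢⇒< kp≤kq (k-injective up uq p≢q)))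

module _ (π : Permutation) (U : ℕ → Set) (U⊆S : ∀ {p} → U p → p ∈ S π) where

  private
    K : Axis → ℕ → ℕ
    K α p = coord α (P π p)

  coord-injective : ∀ β {p q} → U p → U q → p ≢ q → K β p ≢ K β q
  coord-injective ax1 up uq p≢q = proj₁ (general π (U⊆S up) (U⊆S uq) p≢q)
  coord-injective ax2 up uq p≢q = proj₂ (general π (U⊆S up) (U⊆S uq) p≢q)

  Monotone⇒coords-related : Monotone π U → ∀ β α →
                            Monotoneᵘ U (K β) (K α) ⊎ Antitoneᵘ U (K β) (K α)
  Monotone⇒coords-related _ ax1 ax1 = inj₁ (λ _ _ → id)
  Monotone⇒coords-related _ ax2 ax2 = inj₁ (λ _ _ → id)
  Monotone⇒coords-related (inj₁ inc) ax1 ax2 = inj₁ (<-preserving⇒Monotoneᵘ U _ _ (coord-injective ax1)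
    λ {p} {q} up uq → Equivalence.to (inc p q up uq))
  Monotone⇒coords-related (inj₁ inc) ax2 ax1 = inj₁ (<-preserving⇒Monotoneᵘ U _ _ (coord-injective ax2)
    λ {p} {q} up uq → Equivalence.from (inc p q up uq))
  Monotone⇒coords-related (inj₂ dec) ax1 ax2 = inj₂ (<-reversing⇒Antitoneᵘ U _ _ (coord-injective ax1)
    λ {p} {q} up uq → Equivalence.to (dec p q up uq))
  Monotone⇒coords-related (inj₂ dec) ax2 ax1 = inj₂ (<-reversing⇒Antitoneᵘ U _ _ (coord-injective ax2)
    λ {p} {q} up uq → Equivalence.from (dec q p uq up))

  mid-in-monotone-block : Monotone π U → ∀ β α {a b c} → U a → U b → U c →
                          U (mid β π a b c) × IsMedianBy (K α) (mid β π a b c) a b c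
  mid-in-monotone-block mon β α {a} {b} {c} ua ub uc = ur ,
      IsMedianBy-transfer U (K β) (K α) (Monotone⇒coords-related mon β α) ur ua ub uc median-β
    where
    ur = OneOf-preserves {U} (proj₁ (median-spec (K β) a b c)) ua ub uc
    median-β = proj₂ (median-spec (K β) a b c)

proposition10 : (σ π : Permutation) (t : ℕ) (Σ' : MonotonePartition σ t) (Π : MonotonePartition π t)
                (x y : ℕ) (α : Axis) → x ∈ S σ → y ∈ S σ → σ ⊢ x <[ α ] y →
                (β : Axis) → IsPolymorphism (mid β π) (Rel σ π Σ' Π x y α)
proposition10 σ π t Σ' Π x y α _ _ _ β a₁ b₁ a₂ b₂ a₃ b₃
  (a₁∈S , a₁∈i , b₁∈S , b₁∈j , a₁<b₁) (a₂∈S , a₂∈i , b₂∈S , b₂∈j , a₂<b₂) (a₃∈S , a₃∈i , b₃∈S , b₃∈j , a₃<b₃)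
  with mid-in-monotone-block π (Block (part Σ' x)) proj₁ (monotone Π (part Σ' x)) β α
         (a₁∈S , a₁∈i) (a₂∈S , a₂∈i) (a₃∈S , a₃∈i)
     | mid-in-monotone-block π (Block (part Σ' y)) proj₁ (monotone Π (part Σ' y)) β α
         (b₁∈S , b₁∈j) (b₂∈S , b₂∈j) (b₃∈S , b₃∈j)
  where
  Block : Fin t → ℕ → Set
  Block i p = p ∈ S π × part Π p ≡ i
... | (r∈S , r∈i) , r-median | (s∈S , s∈j) , s-median =
  r∈S , r∈i , s∈S , s∈j , IsMedianBy-mono (λ p → coord α (P π p)) r-median s-median a₁<b₁ a₂<b₂ a₃<b₃
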